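{- Let $F$ be a set, $\mathcal D$ a filter on $F$, $(\langle U_f,\gamma_f\rangle)_{f\in F}$ a collection of evaluated systems of a generalized second-order signature $\Sigma_2^g$ with true generalized equalities and belongings, $U=\mathrm{Inf}_{\mathcal D}\prod_{f\in F}U_f$, and $\beta$ an evaluation on $U$. For each $f\in F$ define an evaluation $\delta_f$ on $U_f$ by $\delta_f(x)=\beta(x)(f)$ for variables $x$ of the first-order type and $\delta_f(x)=\beta(x)\langle f\rangle$ for variables $x$ of a second-order type, and let $\delta=\bowtie_{f\in F}\delta_f$. Then $\delta(x^\tau)\approx_\tau\beta(x^\tau)$ for every variable $x^\tau$.
   Context: Types: $0$ is the first-order type; for $k\ge0$, $[\tau_0,\ldots,\tau_k]$ with all $\tau_\mu=0$ is a second-order type; for a set $A$, $0(A)=A$, $\check\tau(A)=A^{k+1}$, $\tau(A)=\mathcal P(A^{k+1})$. A generalized second-order signature $\Sigma_2^g$ has a set $\Theta$ of first- and second-order types (containing $0$ and some second-order type), $\Theta_b$ its second-order types, constant symbols $\sigma^\tau_\omega$, symbols $\delta_\tau$ ($\tau\in\Theta$), $\varepsilon_\tau$ ($\tau\in\Theta_b$), and variables of each type. A system $U=\langle A,S\rangle$: a set $A$, constants $s^\tau_\omega\in\tau(A)$, $\approx_\tau\subseteq\tau(A)^2$ containing identity, $\tilde\in_\tau\subseteq\check\tau(A)\times\tau(A)$ containing membership; an evaluation assigns $\gamma(x^\tau)\in\tau(A)$ to each variable. $U$ has true generalized equalities and belongings if each $\approx_\tau$ is an equivalence relation and, for $\tau=[\tau_0,\ldots,\tau_k]\in\Theta_b$,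 $x_\mu\approx_{\tau_\mu} y_\mu$ (all $\mu$) and $u\approx_\tau v$ imply $((x_\mu)_\mu\mathrel{\tilde\in_\tau}u\Leftrightarrow(y_\mu)_\mu\mathrel{\tilde\in_\tau}v)$. Infra-$\mathcal D$-product $\mathrm{Inf}_{\mathcal D}\prod_{f\in F}U_f$ of $U_f=\langle A_f,S_f\rangle$: support $A=\prod_fA_f$; for $p\in A^{k+1}$, $p(f)\in A_f^{k+1}$ with $p(f)(\mu)=p(\mu)(f)$; for $P\subseteq A^{k+1}$, $P\langle f\rangle=\{p(f):p\in P\}$; constants $s^0_\omega(f)=s^0_{\omega f}$ and $s^\tau_\omega=\{p:\forall f\ p(f)\in s^\tau_{\omega f}\}$ for second-order $\tau$; $p\approx_0 q$ iff $\exists G\in\mathcal D\,\forall g\in G\ p(g)\approx_{0,g}q(g)$; $P\approx_\tau Q$ iff $\exists G\in\mathcal D\,\forall g\in G\ P\langle g\rangle\approx_{\tau,g}Q\langle g\rangle$; $p\mathrel{\tilde\in_\tau}P$ iff $\exists G\in\mathcal D\,\forall g\in G\ p(g)\mathrel{\tilde\in_{\tau,g}}P\langle g\rangle$. Crossing $\bowtie_f\gamma_f$ of evaluations $\gamma_f$ on $U_f$: $\gamma(x)(f)=\gamma_f(x)$ for type-$0$ variables, $\gamma(x)=\{p\in\check\tau(A):\forall f\ p(f)\in\gamma_f(x)\}$ for variables of second-order type $\tau$. A filter on $F$: family of subsets closed under finite intersections and supersets. -}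

module Defs where

open import Level using (Level; Lift; lift; lower; 0ℓ) renaming (suc to lsuc)
open import Data.Nat using (ℕ; suc)
open import Data.Fin using (Fin)
open import Data.Unit using (⊤; tt)
open import Data.Product using (Σ; ∃; _×_; _,_; proj₁; proj₂)
open import Relation.Unary using (Pred; _∈_; _⊆_; _∩_)
open import Relation.Binary using (Rel; IsEquivalence)
open import Relation.Binary.PropositionalEquality using (_≡_; refl; cong)
open import Function.Bundles using (_⇔_)

-- Types.  `first` is the type 0; `second k` is the second-order type
-- [0,...,0] with k+1 entries.

data Ty : Set where
  first  : Ty
  second : ℕ → Ty

Tuple : Set → ℕ → Set
Tuple A k = Fin (suc k) → A

Sem : Ty → Set → Set₁
Sem first      A = Lift (lsuc 0ℓ) A
Sem (second k) A = Pred (Tuple A k) 0ℓ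

InΘ' : Pred ℕ 0ℓ → Ty → Set
InΘ' Θb first      = ⊤
InΘ' Θb (second k) = k ∈ Θb

record Signature : Set₁ where
  field
    Θb      : Pred ℕ 0ℓ
    Θb-ne   : ∃ λ k → k ∈ Θb

  InΘ : Ty → Set
  InΘ = InΘ' Θb

  field
    Const : (τ : Ty) → InΘ τ → Set
    Var   : (τ : Ty) → InΘ τ → Set

-- identity of elements of τ(A) (sets are extensional)
Same : ∀ {A} (τ : Ty) → Sem τ A → Sem τ A → Set
Same first      (lift a) (lift b) = a ≡ b
Same (second k) P Q               = P ⊆ Q × Q ⊆ P

record System (Sg : Signature) : Set₂ where
  open Signature Sg
  field
    Carrier : Set
    const   : ∀ {τ} (h : InΘ τ) → Const τ h → Sem τ Carrier
    eq      : ∀ {τ} (h : InΘ τ) → Rel (Sem τ Carrier) (lsuc 0ℓ)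
    eq-id   : ∀ {τ} (h : InΘ τ) {u v : Sem τ Carrier} → Same τ u v → eq h u v
    bel     : ∀ {k} (h : k ∈ Θb) → Tuple Carrier k → Sem (second k) Carrier → Set₁
    bel-id  : ∀ {k} (h : k ∈ Θb) {p : Tuple Carrier k} {P : Sem (second k) Carrier} →
              p ∈ P → bel h p P

module _ {Sg : Signature} where
  open Signature Sg

  Eval : System Sg → Set₁
  Eval U = ∀ {τ} (h : InΘ τ) → Var τ h → Sem τ (System.Carrier U)

  record TrueEqBel (U : System Sg) : Set₁ where
    open System U
    field
      equiv : ∀ {τ} (h : InΘ τ) → IsEquivalence (eq {τ} h)
      compat : ∀ {k} (h : k ∈ Θb) {x y : Tuple Carrier k} {u v : Sem (second k) Carrier} →
               (∀ μ → eq {first} tt (lift (x μ)) (lift (y μ))) → eq h u v →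
               (bel h x u ⇔ bel h y v)

record Filter (F : Set) : Set₂ where
  field
    member : Pred (Pred F 0ℓ) (lsuc 0ℓ)
    top    : member (λ _ → ⊤)
    inter  : ∀ {G H} → member G → member H → member (G ∩ H)
    up     : ∀ {G H} → member G → G ⊆ H → member H

module _ {Sg : Signature} {F : Set} (D : Filter F) (U : F → System Sg) where
  open Signature Sg
  open Filter D

  private
    Af : F → Set
    Af f = System.Carrier (U f)

  ProdCarrier : Set
  ProdCarrier = (f : F) → Af f

  at : ∀ {k} → Tuple ProdCarrier k → (f : F) → Tuple (Af f) k
  at p f μ = p μ f

  proj : ∀ {k} → Sem (second k) ProdCarrier → (f : F) → Sem (second k) (Af f)
  proj P f q = ∃ λ p → P p × (∀ μ → at p f μ ≡ q μ)

  private
    pconst : ∀ {τ} (h : InΘ τ) → Const τ h → Sem τ ProdCarrier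
    pconst {first}    h c = lift (λ f → lower (System.const (U f) h c))
    pconst {second k} h c = λ p → ∀ f → at p f ∈ System.const (U f) h c

    peq : ∀ {τ} (h : InΘ τ) → Rel (Sem τ ProdCarrier) (lsuc 0ℓ)
    peq {first} h (lift p) (lift q) =
      ∃ λ G → member G × (∀ g → g ∈ G → System.eq (U g) tt (lift (p g)) (lift (q g)))
    peq {second k} h P Q =
      ∃ λ G → member G × (∀ g → g ∈ G → System.eq (U g) h (proj P g) (proj Q g))

    peq-id : ∀ {τ} (h : InΘ τ) {u v : Sem τ ProdCarrier} → Same τ u v → peq h u v
    peq-id {first} h {lift p} {lift q} e =
      (λ _ → ⊤) , top , λ g _ → System.eq-id (U g) tt (cong (λ r → r g) e)
    peq-id {second k} h {P} {Q} (PQ , QP) =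
      (λ _ → ⊤) , top , λ g _ → System.eq-id (U g) h
        ((λ { (p , Pp , e) → p , PQ Pp , e }) , (λ { (p , Qp , e) → p , QP Qp , e }))

    pbel : ∀ {k} (h : k ∈ Θb) → Tuple ProdCarrier k → Sem (second k) ProdCarrier → Set₁
    pbel h p P = ∃ λ G → member G × (∀ g → g ∈ G → System.bel (U g) h (at p g) (proj P g))

    pbel-id : ∀ {k} (h : k ∈ Θb) {p : Tuple ProdCarrier k} {P : Sem (second k) ProdCarrier} →
              p ∈ P → pbel h p P
    pbel-id h {p} Pp = (λ _ → ⊤) , top , λ g _ → System.bel-id (U g) h (p , Pp , λ _ → refl)

  InfProd : System Sg
  InfProd = record
    { Carrier = ProdCarrier
    ; const   = pconst
    ; eq      = peq
    ; eq-id   = peq-id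
    ; bel     = pbel
    ; bel-id  = pbel-id
    }

  cross : ((f : F) → Eval (U f)) → Eval InfProd
  cross γ {first}    h x = lift (λ f → lower (γ f h x))
  cross γ {second k} h x = λ p → ∀ f → at p f ∈ γ f h x

  slice : Eval InfProd → (f : F) → Eval (U f)
  slice β f {first}    h x = lift (lower (β h x) f)
  slice β f {second k} h x = proj (β h x) f

module Submission where

-- Every element u of τ(∏ A_f) has a component u⟨f⟩ at each
-- coordinate f: the value u(f) for the first-order type, the projection
-- P⟨f⟩ for a second-order type.
--
--  * coordinatewise equality: if u⟨g⟩ ≈_{τ,g} v⟨g⟩ for every g, then
--    u ≈_τ v in the infra-D-product (witnessed by F itself, which lies in
--    every filter);
--  * the crossing of the slices of β has literally the same components as
--    β: for first-order variables by definition, and for second-order ones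
--    because projecting the "box" {p | ∀ f. p(f) ∈ P⟨f⟩} back to a
--    coordinate g returns exactly P⟨g⟩.
--
-- Since every ≈_{τ,g} contains the identity, the theorem follows.

open import Defs
open import Level using (lift; lower)
open import Data.Unit using (⊤)
open import Data.Product using (_,_)
open import Relation.Unary using (_∈_)
open import Relation.Binary.PropositionalEquality using (refl; trans)

module _ {Sg : Signature} {F : Set} (D : Filter F) (U : F → System Sg) where
  open Signature Sg

  private
    Π : System Sg
    Π = InfProd D U

  component : ∀ {τ} → Sem τ (ProdCarrier D U) → (g : F) → Sem τ (System.Carrier (U g))
  component {first}    u g = lift (lower u g)
  component {second k} P g = proj D U P g

  box : ∀ {k} → ((f : F) → Sem (second k) (System.Carrier (U f))) →
        Sem (second k) (ProdCarrier D U)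
  box Q p = ∀ f → at D U p f ∈ Q f

  -- Projecting the box of the projections of P to a coordinate g gives back
  -- exactly P⟨g⟩: every tuple of P lies in that box, and conversely a tuple
  -- of the box has its g-th coordinate in P⟨g⟩.
  proj-box-proj : ∀ {k} (P : Sem (second k) (ProdCarrier D U)) (g : F) →
                  Same (second k) (proj D U (box (proj D U P)) g) (proj D U P g)
  proj-box-proj P g = box⟨g⟩⊆P⟨g⟩ , P⟨g⟩⊆box⟨g⟩
    where
      box⟨g⟩⊆P⟨g⟩ : ∀ {q} → proj D U (box (proj D U P)) g q → proj D U P g q
      box⟨g⟩⊆P⟨g⟩ (p , p∈box , p[g]≡q) with p∈box g
      ... | (p′ , p′∈P , p′[g]≡p[g]) = p′ , p′∈P , λ μ → trans (p′[g]≡p[g] μ) (p[g]≡q μ)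

      P⟨g⟩⊆box⟨g⟩ : ∀ {q} → proj D U P g q → proj D U (box (proj D U P)) g q
      P⟨g⟩⊆box⟨g⟩ (p , p∈P , p[g]≡q) = p , (λ f → p , p∈P , λ _ → refl) , p[g]≡q

  -- Elements whose components are ≈-related at every coordinate are ≈-related
  -- in the infra-D-product, since the whole index set F belongs to D.
  coordinatewise-eq : ∀ {τ} (h : InΘ τ) {u v : Sem τ (ProdCarrier D U)} →
                      (∀ g → System.eq (U g) h (component u g) (component v g)) →
                      System.eq Π h u v
  coordinatewise-eq {first}    h u≈v = (λ _ → ⊤) , Filter.top D , λ g _ → u≈v g
  coordinatewise-eq {second k} h u≈v = (λ _ → ⊤) , Filter.top D , λ g _ → u≈v g

  component-cross-slice : (β : Eval Π) → ∀ {τ} (h : InΘ τ) (x : Var τ h) (g : F) →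
                          Same τ (component (cross D U (slice D U β) h x) g)
                                 (component (β h x) g)
  component-cross-slice β {first}    h x g = refl
  component-cross-slice β {second k} h x g = proj-box-proj (β h x) g

proposition4 : {Sg : Signature} (F : Set) (D : Filter F) (U : F → System Sg)
    (γ : (f : F) → Eval (U f)) (tr : (f : F) → TrueEqBel (U f))
    (β : Eval (InfProd D U)) →
    ∀ {τ} (h : Signature.InΘ Sg τ) (x : Signature.Var Sg τ h) →
    System.eq (InfProd D U) h (cross D U (slice D U β) h x) (β h x)
proposition4 F D U _ _ β h x =
  coordinatewise-eq D U h λ g →
    System.eq-id (U g) h (component-cross-slice D U β h x g)
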